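{- Let $k\geq 1$, $q\geq 0$, and let $G$ be a connected graph. If Robber has a winning strategy in the non-monotone game $\mathrm{CR}^k_q(G)$, then $G_0$ and $G_1$ are homomorphism indistinguishable over $\mathcal{T}^k_q$.
   Context: Graphs are finite, simple, undirected. For $U\subseteq V(G)$, the graph $G_U$ has vertices $(v,S)$ for $v\in V(G)$ and $S\subseteq E(v)$ (edges incident to $v$) with $|S|\equiv|\{v\}\cap U|\pmod 2$, and an edge $(v,S)(u,T)$ whenever $uv\in E(G)$ and $uv\notin S\triangle T$. $G_0:=G_\emptyset$ and $G_1:=G_U$ for any $U\subseteq V(G)$ of odd size (for connected $G$ these are all isomorphic). The non-monotone $q$-round $k$-cops-and-robber game $\mathrm{CR}^k_q(G)$ is played on $G'$, obtained from $G$ by adding a disjoint $k$-clique $K$; cop positions are $k$-subsets $X\subseteq V(G')$, the robber is on a vertex of $G$; initially cops are on $K$ and Robber picks a vertex; in round $i\leq q$ Cops chooses $X_{i+1}$ with $|X_i\cap X_{i+1}|=k-1$, Robber moves along a path from $v_i$ to $v_{i+1}$ with no inner vertex in $X_i\cap X_{i+1}$, and Cops wins if $v_{i+1}\in X_{i+1}$; Robber wins if Cops has not won after $q$ rounds. A rooted forest is viewed as its ancestor order $\preceq$, height = size of longest chain. A $k$-pebble forest cover of a graph $F$ is a rooted forest on $V(F)$ with $p\colon V(F)\to[k]$ such that every edge $uv$ has $u\preceq v$ or $v\preceq u$, and if $uv\in E(F)$, $u\prec v$, then every $w$ with $u\prec w\preceq v$ has $p(w)\neq p(u)$; depth = height.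 $\mathcal{T}^k_q$: graphs with a $k$-pebble forest cover of depth at most $q$. Homomorphism indistinguishable over $\mathcal{F}$: $\hom(F,G_0)=\hom(F,G_1)$ for all $F\in\mathcal{F}$. -}

module Defs where

open import Data.Nat using (ℕ; zero; suc; _+_; _∸_; _%_; _≤_)
open import Data.Bool using (Bool; true; false; not; _∧_; _∨_; _xor_; if_then_else_; T)
open import Data.Fin using (Fin; _↑ˡ_)
open import Data.Vec using (Vec; []; _∷_; lookup; replicate; _++_)
open import Data.List using (List; [_]; length; map; concatMap; allFin; filterᵇ; foldr)
open import Data.List.Relation.Unary.AllPairs using (AllPairs)
open import Data.Fin.Subset using (Subset; _∈_; _∉_; _∩_; ∣_∣)
open import Data.Product using (Σ; _×_; _,_; proj₁; proj₂)
open import Data.Sum using (_⊎_)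
open import Data.Unit using (⊤)
open import Data.Empty using (⊥)
open import Relation.Nullary using (¬_)
open import Relation.Binary.PropositionalEquality using (_≡_; _≢_)

record Graph : Set where
  field
    n     : ℕ
    adj   : Fin n → Fin n → Bool
    sym   : ∀ u v → adj u v ≡ adj v u
    irr   : ∀ v → adj v v ≡ false
open Graph public

-- Homomorphism counts into a finite target given by an explicit
-- duplicate-free list of its vertices and a Boolean adjacency.

allB : {A : Set} → (A → Bool) → List A → Bool
allB p = foldr (λ a b → p a ∧ b) true

vecs : {A : Set} → (m : ℕ) → List A → List (Vec A m)
vecs zero    L = [ [] ]
vecs (suc m) L = concatMap (λ a → map (a ∷_) (vecs m L)) L

isHom : {A : Set} → (F : Graph) → (A → A → Bool) → Vec A (n F) → Bool
isHom F adjH f =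
  allB (λ i → allB (λ j → not (adj F i j) ∨ adjH (lookup f i) (lookup f j))
                 (allFin (n F)))
      (allFin (n F))

homCount : {A : Set} → (F : Graph) → List A → (A → A → Bool) → ℕ
homCount F L adjH = length (filterᵇ (isHom F adjH) (vecs (n F) L))

-- The CFI-type graphs G_U.
-- A subset S of the edges incident to v is represented by the subset
-- of Fin n of the other endpoints (S ⊆ N(v)); edge uv ∈ S iff S[u].

subsets : (m : ℕ) → List (Subset m)
subsets zero    = [ [] ]
subsets (suc m) = concatMap (λ b → map (b ∷_) (subsets m)) (true ∷ false ∷ [])
  where open Data.List using (_∷_; [])

bit : Bool → ℕ
bit true  = 1
bit false = 0

validB : (G : Graph) → Subset (n G) → Fin (n G) × Subset (n G) → Bool
validB G U (v , S) =
  allB (λ u → not (lookup S u) ∨ adj G v u) (allFin (n G))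
  ∧ (Data.Nat._≡ᵇ_ (∣ S ∣ % 2) (bit (lookup U v)))

CFIVertices : (G : Graph) → Subset (n G) → List (Fin (n G) × Subset (n G))
CFIVertices G U =
  filterᵇ (validB G U)
    (concatMap (λ v → map (v ,_) (subsets (n G))) (allFin (n G)))

CFIAdj : (G : Graph) → Fin (n G) × Subset (n G) → Fin (n G) × Subset (n G) → Bool
CFIAdj G (v , S) (u , T) = adj G v u ∧ not (lookup S u xor lookup T v)

homCFI : (F G : Graph) → Subset (n G) → ℕ
homCFI F G U = homCount F (CFIVertices G U) (CFIAdj G)

HomIndistCFI : (G : Graph) → Subset (n G) → Subset (n G) → (Graph → Set₁) → Set₁
HomIndistCFI G U W 𝓕 = ∀ F → 𝓕 F → homCFI F G U ≡ homCFI F G W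

data Reach (G : Graph) (P : Fin (n G) → Set) : Fin (n G) → Fin (n G) → Set where
  here : ∀ {u} → Reach G P u u
  edge : ∀ {u w} → adj G u w ≡ true → Reach G P u w
  via  : ∀ {u x w} → adj G u x ≡ true → ¬ P x → Reach G P x w → Reach G P u w

Connected : Graph → Set
Connected G = ∀ u v → Reach G (λ _ → ⊥) u v

-- The non-monotone q-round k-cops-and-robber game CR^k_q(G).
-- G' has vertex set Fin (n G + k): G-vertices are v ↑ˡ k,
-- the k-clique K consists of the vertices raise (n G) i.

module Game (G : Graph) (k : ℕ) where
  Pos : Set
  Pos = Subset (n G + k)

  gv : Fin (n G) → Fin (n G + k)
  gv v = v ↑ˡ k

  K : Pos
  K = replicate (n G) false ++ replicate k true

  -- Robber, at vertex v with cops on X, survives r further rounds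
  RobberWins : ℕ → Pos → Fin (n G) → Set
  RobberWins zero    X v = ⊤
  RobberWins (suc r) X v =
    (X' : Pos) → ∣ X' ∣ ≡ k → ∣ X ∩ X' ∣ ≡ k ∸ 1 →
    Σ (Fin (n G)) λ v' →
      Reach G (λ w → gv w ∈ (X ∩ X')) v v' × gv v' ∉ X' × RobberWins r X' v'

  RobberWinsCR : ℕ → Set
  RobberWinsCR q = Σ (Fin (n G)) λ v → RobberWins q K v

-- k-pebble forest covers, given as ancestor orders _⪯_ of rooted forests

record PebbleForestCover (F : Graph) (k q : ℕ) : Set₁ where
  field
    _⪯_     : Fin (n F) → Fin (n F) → Set
    p       : Fin (n F) → Fin k
    refl⪯   : ∀ u → u ⪯ u
    antisym : ∀ u v → u ⪯ v → v ⪯ u → u ≡ v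
    trans⪯  : ∀ u v w → u ⪯ v → v ⪯ w → u ⪯ w
    forest  : ∀ u w v → u ⪯ v → w ⪯ v → u ⪯ w ⊎ w ⪯ u
    -- depth (height = size of a longest chain) at most q
    height  : ∀ (c : List (Fin (n F))) →
              AllPairs (λ a b → a ≢ b × (a ⪯ b ⊎ b ⪯ a)) c → length c ≤ q
    edgeComp : ∀ u v → adj F u v ≡ true → u ⪯ v ⊎ v ⪯ u
    pebble  : ∀ u v → adj F u v ≡ true → u ⪯ v → u ≢ v →
              ∀ w → u ⪯ w → u ≢ w → w ⪯ v → p w ≢ p u

𝒯 : ℕ → ℕ → Graph → Set₁
𝒯 k q F = PebbleForestCover F k q

module Submission where

-- A robber strategy yields, for every map h : V(F) → V(G), a set D x of edges at
-- h x for each x, of parity U (h x), such that D x and D y agree on the edge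
-- h x h y whenever xy ∈ E(F). Twisting the CFI vertices over h by D is then an
-- involution matching the homomorphisms F → G_∅ and F → G_U over h.
--
-- To find D, walk down the pebble forest cover: x places cop p x on h x, and the
-- robber answers with a walk. A τ-join with τ = U ⊕ {robber} is carried along,
-- adding each walk to it, and D x is its set of edges at h x when x is reached.
-- The robber is never on h x then, so D x has parity U (h x). For an edge x ⪯ y,
-- the pebble condition keeps cop p x on h x until y is reached, and the robber's
-- walks never pass through cops, so the edges at h x are unchanged.

open import Defs hiding (sym)

open import Algebra.Bundles using (CommutativeRing)
import Algebra.Properties.Semiring.Sum as SemiringSum
open import Data.Bool using (Bool; true; false; not; _∧_; _∨_; _xor_; T; T?; if_then_else_)
open import Data.Bool.Properties
  using ( xor-∧-commutativeRing; ∧-comm; ∧-idem; ∧-identityʳ; ∧-zeroʳ; ∨-zeroʳ; ∧-distribˡ-xor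
        ; xor-assoc; xor-comm; xor-same; xor-identityʳ; xor-annihilates-not)
open import Data.Empty using (⊥-elim)
open import Data.Fin using (Fin; zero; suc; punchIn; punchOut; _↑ʳ_)
open import Data.Fin.Properties using (_≟_; punchIn-punchOut)
open import Data.Fin.Subset using (Subset; ∣_∣; _∩_; ⊥; ⊤)
import Data.Fin.Subset as Subset
open import Data.Fin.Subset.Properties using (x∈p∩q⁺; ∣⊤∣≡n)
open import Data.List
  using (List; []; _∷_; _++_; length; map; concatMap; cartesianProductWith; filter; filterᵇ; find; allFin)
open import Data.List.Membership.Propositional using (_∈_)
open import Data.List.Membership.Propositional.Properties using (∈-map⁺; ∈-allFin; ∈-cartesianProductWith⁺)
open import Data.List.Membership.Propositional.Properties.WithK using (unique∧set⇒bag)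
open import Data.List.Properties using (filter-some; filter-++; filter-≐; length-map)
open import Data.List.Relation.Binary.BagAndSetEquality using (∼bag⇒↭)
open import Data.List.Relation.Binary.Permutation.Propositional using (_↭_)
open import Data.List.Relation.Binary.Permutation.Propositional.Properties using (filter-↭; ↭-length)
open import Data.List.Relation.Unary.All using (All; []; _∷_)
open import Data.List.Relation.Unary.AllPairs using (AllPairs; []; _∷_)
open import Data.List.Relation.Unary.Any using (here; there)
import Data.List.Relation.Unary.Any as Any
open import Data.List.Relation.Unary.Unique.Propositional using (Unique)
import Data.List.Relation.Unary.Unique.Propositional.Properties as Unique
open import Data.Maybe using (Maybe; just; nothing; maybe)
open import Data.Nat using (ℕ; zero; suc; _+_; _∸_; _%_; _≡ᵇ_; _≤_; _<_; _≥_; s≤s; z≤n)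
open import Data.Nat.DivMod using (%-distribˡ-+)
open import Data.Nat.Properties
  using ( +-suc; +-identityʳ; +-monoʳ-≤; ≤-refl; ≤-trans; ≤-pred; n≤1+n; m≤n⇒m≤1+n
        ; <-irrefl; <-≤-trans; ≤∧≢⇒<; suc-injective)
  renaming (_≟_ to _≟ℕ_)
open import Data.Product using (Σ; _×_; _,_; proj₁; proj₂)
open import Data.Sum using (_⊎_; inj₁; inj₂)
open import Data.Vec using (Vec; []; _∷_; lookup; tabulate; zipWith; _[_]≔_; replicate)
import Data.Vec as Vec
open import Data.Vec.Functional using (updateAt)
open import Data.Vec.Functional.Properties using (updateAt-updates; updateAt-minimal)
open import Data.Vec.Properties
  using ( lookup⇒[]=; lookup-++ˡ; lookup-++ʳ; lookup∘update; lookup∘update′; lookup∘tabulate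
        ; tabulate∘lookup; tabulate-cong; lookup-zipWith; lookup-map; lookup-replicate)
open import Function using (_∘_; mk⇔)
open import Relation.Binary.PropositionalEquality
  using (_≡_; _≢_; _≗_; refl; sym; trans; cong; cong₂; subst; subst₂; module ≡-Reasoning)
open import Relation.Nullary using (¬_; Dec; does; yes; no; _×-dec_)
open import Relation.Nullary.Decidable using (dec-true; dec-false; decidable-stable; ¬¬-excluded-middle)
open import Relation.Nullary.Negation using (¬¬-map)
open import Relation.Unary using (Decidable)

open SemiringSum (CommutativeRing.semiring xor-∧-commutativeRing)
  using (sum; sum-cong-≗; ∑-distrib-+; *-distribˡ-sum; *-distribʳ-sum; sum-replicate-zero)

xor-cancelʳ : ∀ a b → (a xor b) xor b ≡ a
xor-cancelʳ a b = trans (xor-assoc a b b) (trans (cong (a xor_) (xor-same b)) (xor-identityʳ a))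

xor-cancel-middle : ∀ t x w → (t xor x) xor (x xor w) ≡ t xor w
xor-cancel-middle t x w = begin
  (t xor x) xor (x xor w) ≡⟨ xor-assoc t x (x xor w) ⟩
  t xor (x xor (x xor w)) ≡⟨ cong (t xor_) (sym (xor-assoc x x w)) ⟩
  t xor ((x xor x) xor w) ≡⟨ cong (λ z → t xor (z xor w)) (xor-same x) ⟩
  t xor w                 ∎
  where open ≡-Reasoning

xor-telescope : ∀ t u x w → (t xor (u xor x)) xor (x xor w) ≡ t xor (u xor w)
xor-telescope t u x w = begin
  (t xor (u xor x)) xor (x xor w) ≡⟨ cong (_xor (x xor w)) (sym (xor-assoc t u x)) ⟩
  ((t xor u) xor x) xor (x xor w) ≡⟨ xor-cancel-middle (t xor u) x w ⟩
  (t xor u) xor w                 ≡⟨ xor-assoc t u w ⟩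
  t xor (u xor w)                 ∎
  where open ≡-Reasoning

δ : ∀ {m} → Fin m → Fin m → Bool
δ a b = does (a ≟ b)

δ-refl : ∀ {m} (a : Fin m) → δ a a ≡ true
δ-refl a = dec-true (a ≟ a) refl

δ-≢ : ∀ {m} {a b : Fin m} → a ≢ b → δ a b ≡ false
δ-≢ {a = a} {b} = dec-false (a ≟ b)

sum-false : ∀ {m} → sum {m} (λ _ → false) ≡ false
sum-false {m} = sum-replicate-zero m

sum-∧δ : ∀ {m} (f : Fin m → Bool) (a : Fin m) → sum (λ i → f i ∧ δ a i) ≡ f a
sum-∧δ {suc m} f zero = begin
  (f zero ∧ true) xor sum (λ i → f (suc i) ∧ false)
    ≡⟨ cong₂ _xor_ (∧-identityʳ (f zero)) (trans (sum-cong-≗ (λ i → ∧-zeroʳ (f (suc i)))) (sum-false {m})) ⟩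
  f zero xor false
    ≡⟨ xor-identityʳ (f zero) ⟩
  f zero ∎
  where open ≡-Reasoning
sum-∧δ f (suc a) = trans (cong (_xor sum (λ i → f (suc i) ∧ δ a i)) (∧-zeroʳ (f zero))) (sum-∧δ (f ∘ suc) a)

sum-δ : ∀ {m} (a : Fin m) → sum (δ a) ≡ true
sum-δ = sum-∧δ (λ _ → true)

δ-sym : ∀ {m} (a b : Fin m) → δ a b ≡ δ b a
δ-sym a b with a ≟ b
... | yes refl = sym (δ-refl a)
... | no a≢b   = sym (δ-≢ (a≢b ∘ sym))

δ⇒≡ : ∀ {m} {a b : Fin m} → δ a b ≡ true → a ≡ b
δ⇒≡ {a = a} {b} e with a ≟ b
... | yes a≡b = a≡b

[1+bit]%2 : ∀ b → (1 + bit b) % 2 ≡ bit (true xor b)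
[1+bit]%2 true  = refl
[1+bit]%2 false = refl

∣p∣%2≡parity : ∀ {m} (p : Subset m) → ∣ p ∣ % 2 ≡ bit (sum (lookup p))
∣p∣%2≡parity []          = refl
∣p∣%2≡parity (true ∷ p)  = begin
  (1 + ∣ p ∣) % 2          ≡⟨ %-distribˡ-+ 1 ∣ p ∣ 2 ⟩
  (1 + ∣ p ∣ % 2) % 2      ≡⟨ cong (λ r → (1 + r) % 2) (∣p∣%2≡parity p) ⟩
  (1 + bit (sum (lookup p))) % 2 ≡⟨ [1+bit]%2 (sum (lookup p)) ⟩
  bit (true xor sum (lookup p)) ∎
  where open ≡-Reasoning
∣p∣%2≡parity (false ∷ p) = ∣p∣%2≡parity p

_⊕_ : ∀ {m} → Subset m → Subset m → Subset m
_⊕_ = zipWith _xor_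

lookup-⊕ : ∀ {m} (p q : Subset m) i → lookup (p ⊕ q) i ≡ lookup p i xor lookup q i
lookup-⊕ p q i = lookup-zipWith _xor_ i p q

lookup-ext : ∀ {A : Set} {m} {u v : Vec A m} → lookup u ≗ lookup v → u ≡ v
lookup-ext {u = u} {v} e = trans (sym (tabulate∘lookup u)) (trans (tabulate-cong e) (tabulate∘lookup v))

⊕-cancelʳ : ∀ {m} (p q : Subset m) → (p ⊕ q) ⊕ q ≡ p
⊕-cancelʳ p q = lookup-ext λ i → trans (lookup-⊕ (p ⊕ q) q i)
  (trans (cong (_xor lookup q i) (lookup-⊕ p q i)) (xor-cancelʳ (lookup p i) (lookup q i)))

parity-⊕ : ∀ {m} (p q : Subset m) → sum (lookup (p ⊕ q)) ≡ sum (lookup p) xor sum (lookup q)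
parity-⊕ p q = trans (sum-cong-≗ (lookup-⊕ p q)) (∑-distrib-+ (lookup p) (lookup q))

odd⇒parity : ∀ {m} (p : Subset m) → ∣ p ∣ % 2 ≡ 1 → sum (lookup p) ≡ true
odd⇒parity p odd with sum (lookup p) | ∣p∣%2≡parity p
... | true  | _ = refl
... | false | e with () ← trans (sym odd) e

module _ {A : Set} where

  filterᵇ-cong : {p q : A → Bool} → p ≗ q → filterᵇ p ≗ filterᵇ q
  filterᵇ-cong {p} {q} p≗q =
    filter-≐ (T? ∘ p) (T? ∘ q) ((λ {x} → subst T (p≗q x)) , (λ {x} → subst T (sym (p≗q x))))

  filterᵇ-filterᵇ : (p q : A → Bool) → ∀ xs → filterᵇ q (filterᵇ p xs) ≡ filterᵇ (λ x → p x ∧ q x) xs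
  filterᵇ-filterᵇ p q [] = refl
  filterᵇ-filterᵇ p q (x ∷ xs) with p x
  ... | false = filterᵇ-filterᵇ p q xs
  ... | true with q x
  ...   | true  = cong (x ∷_) (filterᵇ-filterᵇ p q xs)
  ...   | false = filterᵇ-filterᵇ p q xs

  filterᵇ-const-false : ∀ (xs : List A) → filterᵇ (λ _ → false) xs ≡ []
  filterᵇ-const-false []       = refl
  filterᵇ-const-false (x ∷ xs) = filterᵇ-const-false xs

module _ {A B : Set} where

  filterᵇ-map : (p : B → Bool) (f : A → B) → ∀ xs → filterᵇ p (map f xs) ≡ map f (filterᵇ (p ∘ f) xs)
  filterᵇ-map p f [] = refl
  filterᵇ-map p f (x ∷ xs) with p (f x)
  ... | true  = cong (f x ∷_) (filterᵇ-map p f xs)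
  ... | false = filterᵇ-map p f xs

module _ {A : Set} {P : A → Set} (P? : Decidable P) where

  find-sound : ∀ xs {w} → find P? xs ≡ just w → P w
  find-sound (x ∷ xs) e with P? x
  find-sound (x ∷ xs) refl | yes Px = Px
  ... | no _ = find-sound xs e

  find-unique : ∀ {xs x} → x ∈ xs → P x → (∀ {w} → P w → w ≡ x) → find P? xs ≡ just x
  find-unique {y ∷ xs} x∈ Px unique with P? y
  ... | yes Py = cong just (unique Py)
  find-unique (here refl) Px unique | no ¬Px = ⊥-elim (¬Px Px)
  find-unique (there x∈) Px unique | no _   = find-unique x∈ Px unique

  find-cong : ∀ {Q : A → Set} (Q? : Decidable Q) → (∀ {x} → P x → Q x) → (∀ {x} → Q x → P x) →
    ∀ xs → find P? xs ≡ find Q? xs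
  find-cong Q? P⇒Q Q⇒P []       = refl
  find-cong Q? P⇒Q Q⇒P (x ∷ xs) with P? x | Q? x
  ... | yes _  | yes _  = refl
  ... | no  _  | no  _  = find-cong Q? P⇒Q Q⇒P xs
  ... | yes Px | no ¬Qx = ⊥-elim (¬Qx (P⇒Q Px))
  ... | no ¬Px | yes Qx = ⊥-elim (¬Px (Q⇒P Qx))

  length-filter-mono : ∀ {Q : A → Set} (Q? : Decidable Q) → (∀ {x} → P x → Q x) →
    ∀ xs → length (filter P? xs) ≤ length (filter Q? xs)
  length-filter-mono Q? P⇒Q []       = z≤n
  length-filter-mono Q? P⇒Q (x ∷ xs) with P? x | Q? x
  ... | yes _  | yes _  = s≤s (length-filter-mono Q? P⇒Q xs)
  ... | no  _  | yes _  = m≤n⇒m≤1+n (length-filter-mono Q? P⇒Q xs)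
  ... | no  _  | no  _  = length-filter-mono Q? P⇒Q xs
  ... | yes Px | no ¬Qx = ⊥-elim (¬Qx (P⇒Q Px))

  length-filter-mono-< : ∀ {Q : A → Set} (Q? : Decidable Q) → (∀ {x} → P x → Q x) →
    ∀ {xs x} → x ∈ xs → ¬ P x → Q x → length (filter P? xs) < length (filter Q? xs)
  length-filter-mono-< Q? P⇒Q {y ∷ xs} x∈ ¬Px Qx with P? y | Q? y | x∈
  ... | yes _  | yes _  | there x∈′   = s≤s (length-filter-mono-< Q? P⇒Q x∈′ ¬Px Qx)
  ... | yes Py | yes _  | here refl   = ⊥-elim (¬Px Py)
  ... | no  _  | yes _  | _           = s≤s (length-filter-mono Q? P⇒Q xs)
  ... | no  _  | no ¬Qy | here refl   = ⊥-elim (¬Qy Qx)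
  ... | no  _  | no  _  | there x∈′   = length-filter-mono-< Q? P⇒Q x∈′ ¬Px Qx
  ... | yes Py | no ¬Qy | _           = ⊥-elim (¬Qy (P⇒Q Py))

Enumerates : {A : Set} → List A → Set
Enumerates {A} xs = Unique xs × (∀ a → a ∈ xs)

module _ {A : Set} {xs : List A} (enum : Enumerates xs) (σ : A → A) (σ-involutive : ∀ x → σ (σ x) ≡ x) where

  map-involution-↭ : map σ xs ↭ xs
  map-involution-↭ = ∼bag⇒↭ (unique∧set⇒bag (Unique.map⁺ σ-injective (proj₁ enum)) (proj₁ enum)
    (λ {x} → mk⇔ (λ _ → proj₂ enum x) (λ _ → subst (_∈ map σ xs) (σ-involutive x) (∈-map⁺ σ (proj₂ enum (σ x))))))
    where
    σ-injective : ∀ {x y} → σ x ≡ σ y → x ≡ y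
    σ-injective {x} {y} e = trans (sym (σ-involutive x)) (trans (cong σ e) (σ-involutive y))

  length-filterᵇ-involution : (p q : A → Bool) → (∀ x → p x ≡ q (σ x)) →
    length (filterᵇ p xs) ≡ length (filterᵇ q xs)
  length-filterᵇ-involution p q p≗q∘σ = begin
    length (filterᵇ p xs)            ≡⟨ cong length (filterᵇ-cong p≗q∘σ xs) ⟩
    length (filterᵇ (q ∘ σ) xs)       ≡⟨ sym (length-map σ (filterᵇ (q ∘ σ) xs)) ⟩
    length (map σ (filterᵇ (q ∘ σ) xs)) ≡⟨ cong length (sym (filterᵇ-map q σ xs)) ⟩
    length (filterᵇ q (map σ xs))     ≡⟨ ↭-length (filter-↭ (T? ∘ q) map-involution-↭) ⟩
    length (filterᵇ q xs)            ∎
    where open ≡-Reasoning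

concatMap≡cartesianProductWith : {A B C : Set} (g : A → B → C) (xs : List A) (ys : List B) →
  concatMap (λ a → map (g a) ys) xs ≡ cartesianProductWith g xs ys
concatMap≡cartesianProductWith g []       ys = refl
concatMap≡cartesianProductWith g (x ∷ xs) ys = cong (map (g x) ys ++_) (concatMap≡cartesianProductWith g xs ys)

pairing-enumerates : {A B C : Set} (g : A → B → C) →
  (∀ {a a′ b b′} → g a b ≡ g a′ b′ → a ≡ a′ × b ≡ b′) → (∀ c → Σ A λ a → Σ B λ b → g a b ≡ c) →
  ∀ {xs ys} → Enumerates xs → Enumerates ys → Enumerates (concatMap (λ a → map (g a) ys) xs)
pairing-enumerates g g-injective g-surjective {xs} {ys} (xs! , xs-complete) (ys! , ys-complete)
  rewrite concatMap≡cartesianProductWith g xs ys =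
    Unique.cartesianProductWith⁺ g g-injective xs! ys! , complete
  where
  complete : ∀ c → c ∈ cartesianProductWith g xs ys
  complete c with g-surjective c
  ... | a , b , refl = ∈-cartesianProductWith⁺ g (xs-complete a) (ys-complete b)

vecs-enumerates : {A : Set} {xs : List A} → Enumerates xs → ∀ m → Enumerates (vecs m xs)
vecs-enumerates enum zero    = ([] ∷ []) , λ { [] → here refl }
vecs-enumerates enum (suc m) =
  pairing-enumerates _∷_ (λ { refl → refl , refl }) (λ { (a ∷ v) → a , v , refl })
    enum (vecs-enumerates enum m)

subsets≡vecs : ∀ m → subsets m ≡ vecs m (true ∷ false ∷ [])
subsets≡vecs zero    = refl
subsets≡vecs (suc m) rewrite subsets≡vecs m = refl

subsets-enumerates : ∀ m → Enumerates (subsets m)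
subsets-enumerates m rewrite subsets≡vecs m = vecs-enumerates bools m
  where
  bools : Enumerates (true ∷ false ∷ [])
  bools = ((λ ()) ∷ []) ∷ [] ∷ [] , λ { true → here refl ; false → there (here refl) }

candidates : ∀ N → List (Fin N × Subset N)
candidates N = concatMap (λ v → map (v ,_) (subsets N)) (allFin N)

candidates-enumerates : ∀ N → Enumerates (candidates N)
candidates-enumerates N =
  pairing-enumerates _,_ (λ { refl → refl , refl }) (λ c → proj₁ c , proj₂ c , refl)
    (Unique.allFin⁺ N , ∈-allFin) (subsets-enumerates N)

allᵛ : {A : Set} {m : ℕ} → (A → Bool) → Vec A m → Bool
allᵛ p []      = true
allᵛ p (a ∷ v) = p a ∧ allᵛ p v

vecs-filterᵇ : {A : Set} (p : A → Bool) (xs : List A) →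
  ∀ m → vecs m (filterᵇ p xs) ≡ filterᵇ (allᵛ p) (vecs m xs)
vecs-filterᵇ p xs zero    = refl
vecs-filterᵇ p xs (suc m) rewrite vecs-filterᵇ p xs m = go xs
  where
  extend : ∀ a → filterᵇ (allᵛ p) (map (a ∷_) (vecs m xs)) ≡
                 (if p a then map (a ∷_) (filterᵇ (allᵛ p) (vecs m xs)) else [])
  extend a rewrite filterᵇ-map (allᵛ p) (a ∷_) (vecs m xs) with p a
  ... | true  = refl
  ... | false = cong (map (a ∷_)) (filterᵇ-const-false (vecs m xs))
  go : ∀ ys → concatMap (λ a → map (a ∷_) (filterᵇ (allᵛ p) (vecs m xs))) (filterᵇ p ys)
            ≡ filterᵇ (allᵛ p) (concatMap (λ a → map (a ∷_) (vecs m xs)) ys)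
  go []       = refl
  go (a ∷ ys) rewrite filter-++ (T? ∘ allᵛ p) (map (a ∷_) (vecs m xs)) (concatMap (λ a → map (a ∷_) (vecs m xs)) ys)
                    | extend a with p a
  ... | true  = cong (map (a ∷_) (filterᵇ (allᵛ p) (vecs m xs)) ++_) (go ys)
  ... | false = go ys

allB-cong : {A : Set} {p q : A → Bool} → p ≗ q → ∀ xs → allB p xs ≡ allB q xs
allB-cong p≗q []       = refl
allB-cong p≗q (x ∷ xs) = cong₂ _∧_ (p≗q x) (allB-cong p≗q xs)

allᵛ-cong : {A : Set} {m : ℕ} {p q : A → Bool} (u v : Vec A m) →
  (∀ i → p (lookup u i) ≡ q (lookup v i)) → allᵛ p u ≡ allᵛ q v
allᵛ-cong []      []      e = refl
allᵛ-cong (a ∷ u) (b ∷ v) e = cong₂ _∧_ (e zero) (allᵛ-cong u v (e ∘ suc))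

-- Twisting homomorphisms into CFI graphs

CFIVertex : Graph → Set
CFIVertex G = Fin (n G) × Subset (n G)

CFIAdj-⊕ : ∀ G {v u} (S R Dᵥ Dᵤ : Subset (n G)) → lookup Dᵥ u ≡ lookup Dᵤ v →
  CFIAdj G (v , S) (u , R) ≡ CFIAdj G (v , S ⊕ Dᵥ) (u , R ⊕ Dᵤ)
CFIAdj-⊕ G {v} {u} S R Dᵥ Dᵤ e
  rewrite lookup-⊕ S Dᵥ u | lookup-⊕ R Dᵤ v | e =
    cong (λ b → adj G v u ∧ not b) (sym (xor-xor-same (lookup S u) (lookup R v) (lookup Dᵤ v)))
  where
  xor-xor-same : ∀ a b d → (a xor d) xor (b xor d) ≡ a xor b
  xor-xor-same a b true  = trans (cong₂ _xor_ (xor-comm a true) (xor-comm b true)) (xor-annihilates-not a b)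
  xor-xor-same a b false = cong₂ _xor_ (xor-identityʳ a) (xor-identityʳ b)

validB-⊕ : ∀ G (U : Subset (n G)) {v} (S Dᵥ : Subset (n G)) →
  (∀ u → lookup Dᵥ u ≡ true → adj G v u ≡ true) → sum (lookup Dᵥ) ≡ lookup U v →
  validB G ⊥ (v , S) ≡ validB G U (v , S ⊕ Dᵥ)
validB-⊕ G U {v} S Dᵥ Dᵥ⊆N parity-Dᵥ = cong₂ _∧_ (allB-cong ⊆N-⊕ (allFin (n G))) parity-⊕Dᵥ
  where
  ⊆N-⊕ : ∀ u → (not (lookup S u) ∨ adj G v u) ≡ (not (lookup (S ⊕ Dᵥ) u) ∨ adj G v u)
  ⊆N-⊕ u rewrite lookup-⊕ S Dᵥ u with lookup Dᵥ u in d | adj G v u in a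
  ... | false | _     = cong (λ s → not s ∨ _) (sym (xor-identityʳ (lookup S u)))
  ... | true  | true  = trans (∨-zeroʳ _) (sym (∨-zeroʳ _))
  ... | true  | false with () ← trans (sym (Dᵥ⊆N u d)) a
  parity-⊕Dᵥ : (∣ S ∣ % 2 ≡ᵇ bit (lookup ⊥ v)) ≡ (∣ S ⊕ Dᵥ ∣ % 2 ≡ᵇ bit (lookup U v))
  parity-⊕Dᵥ rewrite ∣p∣%2≡parity S | ∣p∣%2≡parity (S ⊕ Dᵥ) | parity-⊕ S Dᵥ | parity-Dᵥ
                   | lookup-replicate v false with sum (lookup S) | lookup U v
  ... | true  | true  = refl
  ... | true  | false = refl
  ... | false | true  = refl
  ... | false | false = refl

-- D x is a set of edges at h x, given by their other endpoints.
record Twist (G : Graph) (U : Subset (n G)) (F : Graph) (h : Vec (Fin (n G)) (n F)) : Set where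
  field
    D            : Fin (n F) → Subset (n G)
    D⊆N          : ∀ x u → lookup (D x) u ≡ true → adj G (lookup h x) u ≡ true
    parity-D     : ∀ x → sum (lookup (D x)) ≡ lookup U (lookup h x)
    D-compatible : ∀ x y → adj F x y ≡ true → lookup (D x) (lookup h y) ≡ lookup (D y) (lookup h x)

module _ (G : Graph) (U : Subset (n G)) (F : Graph) (twist : ∀ h → Twist G U F h) where
  open Twist

  private
    base : Vec (CFIVertex G) (n F) → Vec (Fin (n G)) (n F)
    base = Vec.map proj₁

    σ : Vec (CFIVertex G) (n F) → Vec (CFIVertex G) (n F)
    σ f = tabulate λ x → proj₁ (lookup f x) , proj₂ (lookup f x) ⊕ D (twist (base f)) x

    lookup-σ : ∀ f x → lookup (σ f) x ≡ (proj₁ (lookup f x) , proj₂ (lookup f x) ⊕ D (twist (base f)) x)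
    lookup-σ f x = lookup∘tabulate _ x

    lookup-base : ∀ f x → lookup (base f) x ≡ proj₁ (lookup f x)
    lookup-base f x = lookup-map x proj₁ f

    base-σ : ∀ f → base (σ f) ≡ base f
    base-σ f = lookup-ext λ x → trans (lookup-base (σ f) x) (trans (cong proj₁ (lookup-σ f x)) (sym (lookup-base f x)))

    σ-involutive : ∀ f → σ (σ f) ≡ f
    σ-involutive f = lookup-ext λ x → begin
      lookup (σ (σ f)) x
        ≡⟨ lookup-σ (σ f) x ⟩
      proj₁ (lookup (σ f) x) , proj₂ (lookup (σ f) x) ⊕ D (twist (base (σ f))) x
        ≡⟨ cong₂ (λ c h → proj₁ c , proj₂ c ⊕ D (twist h) x) (lookup-σ f x) (base-σ f) ⟩
      proj₁ (lookup f x) , (proj₂ (lookup f x) ⊕ D (twist (base f)) x) ⊕ D (twist (base f)) x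
        ≡⟨ cong (proj₁ (lookup f x) ,_) (⊕-cancelʳ _ _) ⟩
      lookup f x ∎
      where open ≡-Reasoning

    valid-σ : ∀ f → allᵛ (validB G ⊥) f ≡ allᵛ (validB G U) (σ f)
    valid-σ f = allᵛ-cong f (σ f) λ x → trans
      (validB-⊕ G U (proj₂ (lookup f x)) (D (twist (base f)) x)
        (λ u e → subst (λ v → adj G v u ≡ true) (lookup-base f x) (D⊆N (twist (base f)) x u e))
        (trans (parity-D (twist (base f)) x) (cong (lookup U) (lookup-base f x))))
      (cong (validB G U) (sym (lookup-σ f x)))

    isHom-σ : ∀ f → isHom F (CFIAdj G) f ≡ isHom F (CFIAdj G) (σ f)
    isHom-σ f = allB-cong (λ x → allB-cong (edge-σ x) (allFin (n F))) (allFin (n F))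
      where
      edge-σ : ∀ x y → (not (adj F x y) ∨ CFIAdj G (lookup f x) (lookup f y))
                   ≡ (not (adj F x y) ∨ CFIAdj G (lookup (σ f) x) (lookup (σ f) y))
      edge-σ x y rewrite lookup-σ f x | lookup-σ f y with adj F x y in xy
      ... | false = refl
      ... | true  = CFIAdj-⊕ G (proj₂ (lookup f x)) (proj₂ (lookup f y)) _ _
                      (subst₂ (λ a b → lookup (D (twist (base f)) x) a ≡ lookup (D (twist (base f)) y) b)
                        (lookup-base f y) (lookup-base f x) (D-compatible (twist (base f)) x y xy))

    homCFI≡count : ∀ W → homCFI F G W ≡
      length (filterᵇ (λ f → allᵛ (validB G W) f ∧ isHom F (CFIAdj G) f) (vecs (n F) (candidates (n G))))
    homCFI≡count W = trans
      (cong (length ∘ filterᵇ (isHom F (CFIAdj G))) (vecs-filterᵇ (validB G W) (candidates (n G)) (n F)))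
      (cong length (filterᵇ-filterᵇ (allᵛ (validB G W)) (isHom F (CFIAdj G)) (vecs (n F) (candidates (n G)))))

  homCFI-twist : homCFI F G ⊥ ≡ homCFI F G U
  homCFI-twist = trans (homCFI≡count ⊥) (trans
    (length-filterᵇ-involution (vecs-enumerates (candidates-enumerates (n G)) (n F)) σ σ-involutive _ _
      (λ f → cong₂ _∧_ (valid-σ f) (isHom-σ f)))
    (sym (homCFI≡count U)))

-- Joins

EdgeSet : ℕ → Set
EdgeSet N = Fin N → Fin N → Bool

-- τ-joins: edge sets, as symmetric Boolean matrices, whose odd-degree vertices are τ.
record IsJoin (G : Graph) (τ : Fin (n G) → Bool) (T : EdgeSet (n G)) : Set where
  field
    symmetric : ∀ a b → T a b ≡ T b a
    ⊆E        : ∀ a b → T a b ≡ true → adj G a b ≡ true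
    parity    : ∀ a → sum (T a) ≡ τ a
open IsJoin

module _ (G : Graph) where

  IsJoin-resp : ∀ {τ τ′ T} → τ ≗ τ′ → IsJoin G τ T → IsJoin G τ′ T
  IsJoin-resp τ≗τ′ j = record { symmetric = symmetric j ; ⊆E = ⊆E j ; parity = λ a → trans (parity j a) (τ≗τ′ a) }

  ∅-isJoin : IsJoin G (λ _ → false) (λ _ _ → false)
  ∅-isJoin = record { symmetric = λ _ _ → refl ; ⊆E = λ _ _ () ; parity = λ _ → sum-false {n G} }

  ⟦_─_⟧ : Fin (n G) → Fin (n G) → EdgeSet (n G)
  ⟦ a ─ b ⟧ x y = (δ a x ∧ δ b y) xor (δ b x ∧ δ a y)

  ⟦─⟧⊆E : ∀ {a b} → adj G a b ≡ true → ∀ x y → ⟦ a ─ b ⟧ x y ≡ true → adj G x y ≡ true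
  ⟦─⟧⊆E {a} {b} ab x y e with a ≟ x | b ≟ y | b ≟ x | a ≟ y
  ... | yes refl | yes refl | _        | _        = ab
  ... | _        | _        | yes refl | yes refl = trans (Graph.sym G b a) ab
  ... | no _     | _        | no _     | _        with () ← e
  ... | no _     | _        | yes _    | no _     with () ← e
  ... | yes _    | no _     | no _     | _        with () ← e
  ... | yes _    | no _     | yes _    | no _     with () ← e

  toggle : Fin (n G) → Fin (n G) → EdgeSet (n G) → EdgeSet (n G)
  toggle a b T x y = T x y xor ⟦ a ─ b ⟧ x y

  toggle-isJoin : ∀ {τ T a b} → adj G a b ≡ true → IsJoin G τ T →
    IsJoin G (λ x → τ x xor (δ a x xor δ b x)) (toggle a b T)
  toggle-isJoin {τ} {T} {a} {b} ab j = record { symmetric = sym′ ; ⊆E = ⊆E′ ; parity = parity′ }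
    where
    sym′ : ∀ x y → toggle a b T x y ≡ toggle a b T y x
    sym′ x y = cong₂ _xor_ (symmetric j x y)
      (trans (xor-comm (δ a x ∧ δ b y) (δ b x ∧ δ a y)) (cong₂ _xor_ (∧-comm (δ b x) (δ a y)) (∧-comm (δ a x) (δ b y))))
    ⊆E′ : ∀ x y → toggle a b T x y ≡ true → adj G x y ≡ true
    ⊆E′ x y e with T x y in t
    ... | false = ⟦─⟧⊆E ab x y e
    ... | true with ⟦ a ─ b ⟧ x y
    ...   | false = ⊆E j x y t
    ...   | true with () ← e
    parity′ : ∀ x → sum (toggle a b T x) ≡ τ x xor (δ a x xor δ b x)
    parity′ x = begin
      sum (λ y → T x y xor ((δ a x ∧ δ b y) xor (δ b x ∧ δ a y)))
        ≡⟨ ∑-distrib-+ (T x) _ ⟩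
      sum (T x) xor sum (λ y → (δ a x ∧ δ b y) xor (δ b x ∧ δ a y))
        ≡⟨ cong (sum (T x) xor_) (∑-distrib-+ (λ y → δ a x ∧ δ b y) _) ⟩
      sum (T x) xor (sum (λ y → δ a x ∧ δ b y) xor sum (λ y → δ b x ∧ δ a y))
        ≡⟨ cong₂ (λ p q → sum (T x) xor (p xor q))
             (sym (*-distribˡ-sum (δ a x) (δ b))) (sym (*-distribˡ-sum (δ b x) (δ a))) ⟩
      sum (T x) xor ((δ a x ∧ sum (δ b)) xor (δ b x ∧ sum (δ a)))
        ≡⟨ cong₂ (λ p q → p xor ((δ a x ∧ q) xor (δ b x ∧ sum (δ a)))) (parity j x) (sum-δ b) ⟩
      τ x xor ((δ a x ∧ true) xor (δ b x ∧ sum (δ a)))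
        ≡⟨ cong (λ q → τ x xor ((δ a x ∧ true) xor (δ b x ∧ q))) (sum-δ a) ⟩
      τ x xor ((δ a x ∧ true) xor (δ b x ∧ true))
        ≡⟨ cong₂ (λ p q → τ x xor (p xor q)) (∧-identityʳ (δ a x)) (∧-identityʳ (δ b x)) ⟩
      τ x xor (δ a x xor δ b x) ∎
      where open ≡-Reasoning

  ⊕walk : ∀ {P u w} → Reach G P u w → EdgeSet (n G) → EdgeSet (n G)
  ⊕walk here                   T = T
  ⊕walk (edge {u} {w} _)       T = toggle u w T
  ⊕walk (via {u} {x} _ _ walk) T = ⊕walk walk (toggle u x T)

  ⊕walk-isJoin : ∀ {P u w τ T} (walk : Reach G P u w) → IsJoin G τ T →
    IsJoin G (λ a → τ a xor (δ u a xor δ w a)) (⊕walk walk T)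
  ⊕walk-isJoin {u = u} {τ = τ} here j =
    IsJoin-resp (λ a → sym (trans (cong (τ a xor_) (xor-same (δ u a))) (xor-identityʳ (τ a)))) j
  ⊕walk-isJoin (edge ab) j = toggle-isJoin ab j
  ⊕walk-isJoin {u = u} {w} {τ} (via {x = x} ux _ walk) j =
    IsJoin-resp (λ a → xor-telescope (τ a) (δ u a) (δ x a) (δ w a)) (⊕walk-isJoin walk (toggle-isJoin ux j))

  toggle-row : ∀ {a b c} T → c ≢ a → c ≢ b → toggle a b T c ≗ T c
  toggle-row {a} {b} T c≢a c≢b y rewrite δ-≢ (c≢a ∘ sym) | δ-≢ (c≢b ∘ sym) = xor-identityʳ _

  ⊕walk-row : ∀ {P u w c} (walk : Reach G P u w) → P c → c ≢ u → c ≢ w → ∀ T → ⊕walk walk T c ≗ T c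
  ⊕walk-row here              _  _   _   T y = refl
  ⊕walk-row (edge _)          _  c≢u c≢w T y = toggle-row T c≢u c≢w y
  ⊕walk-row {c = c} (via {x = x} _ ¬Px walk) Pc c≢u c≢w T y =
    trans (⊕walk-row walk Pc c≢x c≢w _ y) (toggle-row T c≢u c≢x y)
    where
    c≢x : c ≢ x
    c≢x refl = ¬Px Pc

  -- Join every vertex of τ to the hub by a walk; the hub is hit an even number of times.
  join-exists : Connected G → Fin (n G) → ∀ {τ} → sum τ ≡ false → Σ (EdgeSet (n G)) (IsJoin G τ)
  join-exists conn v {τ} even = proj₁ hub , IsJoin-resp hub-sum (proj₂ hub)
    where
    hubJoin : ∀ {m} (f : Fin m → Fin (n G)) →
      Σ (EdgeSet (n G)) (IsJoin G λ a → sum λ i → τ (f i) ∧ (δ (f i) a xor δ v a))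
    hubJoin {zero}  f = _ , ∅-isJoin
    hubJoin {suc m} f with hubJoin (f ∘ suc) | τ (f zero)
    ... | T , j | false = T , j
    ... | T , j | true  =
      ⊕walk (conn (f zero) v) T ,
      IsJoin-resp (λ a → xor-comm (sum λ i → τ (f (suc i)) ∧ (δ (f (suc i)) a xor δ v a)) _)
                  (⊕walk-isJoin (conn (f zero) v) j)
    hub : Σ (EdgeSet (n G)) (IsJoin G λ a → sum λ i → τ i ∧ (δ i a xor δ v a))
    hub = hubJoin (λ i → i)
    hub-sum : ∀ a → sum (λ i → τ i ∧ (δ i a xor δ v a)) ≡ τ a
    hub-sum a = begin
      sum (λ i → τ i ∧ (δ i a xor δ v a))
        ≡⟨ sum-cong-≗ (λ i → ∧-distribˡ-xor (τ i) (δ i a) (δ v a)) ⟩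
      sum (λ i → (τ i ∧ δ i a) xor (τ i ∧ δ v a))
        ≡⟨ ∑-distrib-+ (λ i → τ i ∧ δ i a) (λ i → τ i ∧ δ v a) ⟩
      sum (λ i → τ i ∧ δ i a) xor sum (λ i → τ i ∧ δ v a)
        ≡⟨ cong₂ _xor_ (sum-cong-≗ (λ i → cong (τ i ∧_) (δ-sym i a))) (sym (*-distribʳ-sum (δ v a) τ)) ⟩
      sum (λ i → τ i ∧ δ a i) xor (sum τ ∧ δ v a)
        ≡⟨ cong₂ (λ p q → p xor (q ∧ δ v a)) (sum-∧δ τ a) even ⟩
      τ a xor false
        ≡⟨ xor-identityʳ (τ a) ⟩
      τ a ∎
      where open ≡-Reasoning

∣p[x]≔false∣ : ∀ {m} (p : Subset m) x → lookup p x ≡ true → suc ∣ p [ x ]≔ false ∣ ≡ ∣ p ∣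
∣p[x]≔false∣ (true ∷ p)  zero    e = refl
∣p[x]≔false∣ (true ∷ p)  (suc x) e = cong suc (∣p[x]≔false∣ p x e)
∣p[x]≔false∣ (false ∷ p) (suc x) e = ∣p[x]≔false∣ p x e

∣p[x]≔true∣ : ∀ {m} (p : Subset m) x → lookup p x ≡ false → ∣ p [ x ]≔ true ∣ ≡ suc ∣ p ∣
∣p[x]≔true∣ (false ∷ p) zero    e = refl
∣p[x]≔true∣ (true ∷ p)  (suc x) e = cong suc (∣p[x]≔true∣ p x e)
∣p[x]≔true∣ (false ∷ p) (suc x) e = ∣p[x]≔true∣ p x e

∣p∣≤1+∣p[x]≔false∣ : ∀ {m} (p : Subset m) x → ∣ p ∣ ≤ suc ∣ p [ x ]≔ false ∣
∣p∣≤1+∣p[x]≔false∣ (true ∷ p)  zero    = ≤-refl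
∣p∣≤1+∣p[x]≔false∣ (false ∷ p) zero    = n≤1+n _
∣p∣≤1+∣p[x]≔false∣ (true ∷ p)  (suc x) = s≤s (∣p∣≤1+∣p[x]≔false∣ p x)
∣p∣≤1+∣p[x]≔false∣ (false ∷ p) (suc x) = ∣p∣≤1+∣p[x]≔false∣ p x

x∉p⇒lookup≡false : ∀ {m} {p : Subset m} {x} → x Subset.∉ p → lookup p x ≡ false
x∉p⇒lookup≡false {p = p} {x} x∉p with lookup p x in e
... | true  = ⊥-elim (x∉p (lookup⇒[]= x p e))
... | false = refl

∣p∣>0⇒∃∈ : ∀ {m} (p : Subset m) → 0 < ∣ p ∣ → Σ (Fin m) λ x → lookup p x ≡ true
∣p∣>0⇒∃∈ (true ∷ p)  _   = zero , refl
∣p∣>0⇒∃∈ (false ∷ p) ∣p∣>0 with ∣p∣>0⇒∃∈ p ∣p∣>0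
... | x , x∈p = suc x , x∈p

∃∈∖image : ∀ {l m} (p : Subset m) (f : Fin l → Fin m) → l < ∣ p ∣ →
  Σ (Fin m) λ x → lookup p x ≡ true × (∀ i → f i ≢ x)
∃∈∖image {zero}  p f l<∣p∣ with ∣p∣>0⇒∃∈ p l<∣p∣
... | x , x∈p = x , x∈p , λ ()
∃∈∖image {suc l} p f l<∣p∣
  with ∃∈∖image (p [ f zero ]≔ false) (f ∘ suc) (≤-pred (≤-trans l<∣p∣ (∣p∣≤1+∣p[x]≔false∣ p (f zero))))
... | x , x∈p′ , x∉f = x , trans (sym (lookup∘update′ f₀≢x p false)) x∈p′ , f≢x
  where
  f₀≢x : x ≢ f zero
  f₀≢x refl with () ← trans (sym (lookup∘update (f zero) p false)) x∈p′
  f≢x : ∀ i → f i ≢ x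
  f≢x zero    = f₀≢x ∘ sym
  f≢x (suc i) = x∉f i

-- Rounds of the game

updateAt-pointwise : ∀ {A : Set} {m} (P : A → Set) (f : Fin m → A) j {x} → P x →
  (∀ i → i ≢ j → P (f i)) → ∀ i → P (updateAt f j (λ _ → x) i)
updateAt-pointwise P f j Px Pf i with i ≟ j
... | yes refl = subst P (sym (updateAt-updates i f)) Px
... | no i≢j   = subst P (sym (updateAt-minimal i j f i≢j)) (Pf i i≢j)

module Play (G : Graph) (k′ : ℕ) (U : Subset (n G)) where
  open Game G (suc k′) using (Pos; gv; K; RobberWins)

  k : ℕ
  k = suc k′

  -- Cops are labelled by Fin k (several may share a vertex). The join accumulates the
  -- robber's walks, so its defect U ⊕ {robber} travels with the robber.
  record State : Set where
    field
      cops        : Pos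
      cop         : Fin k → Fin (n G + k)
      robber      : Fin (n G)
      rounds      : ℕ
      robberWins  : RobberWins rounds cops robber
      join        : EdgeSet (n G)
      ∣cops∣      : ∣ cops ∣ ≡ k
      cop∈cops    : ∀ j → lookup cops (cop j) ≡ true
      robber∉cops : lookup cops (gv robber) ≡ false
      isJoin      : IsJoin G (λ a → lookup U a xor δ robber a) join
  open State public

  -- Cop j moves to t, lifting a cop position a that no other cop uses; the robber answers.
  module Move (s : State) (t : Fin (n G)) (j : Fin k) (t∉cops : lookup (cops s) (gv t) ≡ false) where

    free : Σ (Fin (n G + k)) λ a → lookup (cops s) a ≡ true × (∀ i → cop s (punchIn j i) ≢ a)
    free = ∃∈∖image (cops s) (cop s ∘ punchIn j) (subst (k′ <_) (sym (∣cops∣ s)) ≤-refl)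

    a : Fin (n G + k)
    a = proj₁ free

    a∈cops : lookup (cops s) a ≡ true
    a∈cops = proj₁ (proj₂ free)

    cops⁻ cops′ : Pos
    cops⁻ = cops s [ a ]≔ false
    cops′ = cops⁻ [ gv t ]≔ true

    t≢a : gv t ≢ a
    t≢a t≡a with () ← trans (sym t∉cops) (trans (cong (lookup (cops s)) t≡a) a∈cops)

    t∉cops⁻ : lookup cops⁻ (gv t) ≡ false
    t∉cops⁻ = trans (lookup∘update′ t≢a (cops s) false) t∉cops

    ∣cops′∣ : ∣ cops′ ∣ ≡ k
    ∣cops′∣ = trans (∣p[x]≔true∣ cops⁻ (gv t) t∉cops⁻) (trans (∣p[x]≔false∣ (cops s) a a∈cops) (∣cops∣ s))

    cops∩cops′ : cops s ∩ cops′ ≡ cops⁻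
    cops∩cops′ = lookup-ext pointwise
      where
      pointwise : ∀ i → lookup (cops s ∩ cops′) i ≡ lookup cops⁻ i
      pointwise i rewrite lookup-zipWith _∧_ i (cops s) cops′ with i ≟ gv t | i ≟ a
      ... | yes refl | _        = trans (cong (_∧ lookup cops′ (gv t)) t∉cops) (sym t∉cops⁻)
      ... | no i≢t   | yes refl rewrite lookup∘update′ i≢t cops⁻ true | lookup∘update i (cops s) false = ∧-zeroʳ _
      ... | no i≢t   | no i≢a   rewrite lookup∘update′ i≢t cops⁻ true | lookup∘update′ i≢a (cops s) false = ∧-idem _

    ∣cops∩cops′∣ : ∣ cops s ∩ cops′ ∣ ≡ k ∸ 1
    ∣cops∩cops′∣ = trans (cong ∣_∣ cops∩cops′) (suc-injective (trans (∣p[x]≔false∣ (cops s) a a∈cops) (∣cops∣ s)))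

    cop′ : Fin k → Fin (n G + k)
    cop′ = updateAt (cop s) j (λ _ → gv t)

    cop′∈cops′ : ∀ i → lookup cops′ (cop′ i) ≡ true
    cop′∈cops′ = updateAt-pointwise (λ x → lookup cops′ x ≡ true) (cop s) j (lookup∘update (gv t) cops⁻ true) other
      where
      other : ∀ i → i ≢ j → lookup cops′ (cop s i) ≡ true
      other i i≢j with cop s i ≟ gv t
      ... | yes ≡t = subst (λ x → lookup cops′ x ≡ true) (sym ≡t) (lookup∘update (gv t) cops⁻ true)
      ... | no ≢t = begin
        lookup cops′ (cop s i)    ≡⟨ lookup∘update′ ≢t cops⁻ true ⟩
        lookup cops⁻ (cop s i)    ≡⟨ lookup∘update′ ≢a (cops s) false ⟩
        lookup (cops s) (cop s i) ≡⟨ cop∈cops s i ⟩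
        true                      ∎
        where
        open ≡-Reasoning
        ≢a : cop s i ≢ a
        ≢a = subst (λ i′ → cop s i′ ≢ a) (punchIn-punchOut (i≢j ∘ sym)) (proj₂ (proj₂ free) (punchOut (i≢j ∘ sym)))

    Answer : ℕ → Set
    Answer r = Σ (Fin (n G)) λ v′ → Reach G (λ w → gv w Subset.∈ (cops s ∩ cops′)) (robber s) v′
                                    × gv v′ Subset.∉ cops′ × RobberWins r cops′ v′

    answer : ∀ {r} → RobberWins (suc r) (cops s) (robber s) → Answer r
    answer wins = wins cops′ ∣cops′∣ ∣cops∩cops′∣

    next : ∀ r → Answer r → State
    next r ans = record
      { cops = cops′ ; cop = cop′ ; robber = proj₁ ans ; rounds = r ; robberWins = proj₂ (proj₂ (proj₂ ans))
      ; join = ⊕walk G (proj₁ (proj₂ ans)) (join s)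
      ; ∣cops∣ = ∣cops′∣ ; cop∈cops = cop′∈cops′
      ; robber∉cops = x∉p⇒lookup≡false (proj₁ (proj₂ (proj₂ ans)))
      ; isJoin = IsJoin-resp G (λ b → xor-cancel-middle (lookup U b) (δ (robber s) b) (δ (proj₁ ans) b))
                   (⊕walk-isJoin G (proj₁ (proj₂ ans)) (isJoin s)) }

  relabel : (s : State) (t : Fin (n G)) → Fin k → lookup (cops s) (gv t) ≡ true → State
  relabel s t j t∈cops = record s
    { cop = updateAt (cop s) j (λ _ → gv t)
    ; cop∈cops = updateAt-pointwise (λ x → lookup (cops s) x ≡ true) (cop s) j t∈cops (λ i _ → cop∈cops s i) }

  move : (s : State) (t : Fin (n G)) → Fin k → lookup (cops s) (gv t) ≡ false →
    ∀ r → RobberWins r (cops s) (robber s) → State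
  move s t j t∉cops zero    _    = s
  move s t j t∉cops (suc r) wins = Move.next s t j t∉cops r (Move.answer s t j t∉cops wins)

  -- Cop j goes to t; a round is played only if t is not yet occupied.
  place′ : (s : State) (t : Fin (n G)) → Fin k → ∀ b → lookup (cops s) (gv t) ≡ b → State
  place′ s t j true  t∈cops = relabel s t j t∈cops
  place′ s t j false t∉cops = move s t j t∉cops (rounds s) (robberWins s)

  place : State → Fin (n G) → Fin k → State
  place s t j = place′ s t j _ refl

  place-cop : ∀ s t j → 0 < rounds s → cop (place s t j) j ≡ gv t
  place-cop s t j 0<r = go _ refl
    where
    go : ∀ b e → cop (place′ s t j b e) j ≡ gv t
    go true  _ = updateAt-updates j (cop s)
    go false e with rounds s | robberWins s
    ... | suc r | _ = updateAt-updates j (cop s)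

  rounds-place : ∀ s t j → rounds s ≤ suc (rounds (place s t j))
  rounds-place s t j = go _ refl
    where
    go : ∀ b e → rounds s ≤ suc (rounds (place′ s t j b e))
    go true  _ = n≤1+n _
    go false e with rounds s | robberWins s
    ... | zero  | _ = z≤n
    ... | suc r | _ = ≤-refl

  place-keeps : ∀ s t j {i c} → i ≢ j → cop s i ≡ gv c →
    cop (place s t j) i ≡ gv c × join (place s t j) c ≗ join s c
  place-keeps s t j {i} {c} i≢j i↦c = go _ refl
    where
    go : ∀ b e → cop (place′ s t j b e) i ≡ gv c × join (place′ s t j b e) c ≗ join s c
    go true  _     = trans (updateAt-minimal i j (cop s) i≢j) i↦c , λ _ → refl
    go false t∉cops with rounds s | robberWins s
    ... | zero  | _    = i↦c , λ _ → refl
    ... | suc r | wins =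
      i↦′c ,
      ⊕walk-row G (proj₁ (proj₂ ans)) (x∈p∩q⁺ (lookup⇒[]= (gv c) (cops s) c∈cops , lookup⇒[]= (gv c) cops′ c∈cops′))
                c≢robber c≢v′ (join s)
      where
      open Move s t j t∉cops
      ans : Answer r
      ans = answer wins
      i↦′c : cop′ i ≡ gv c
      i↦′c = trans (updateAt-minimal i j (cop s) i≢j) i↦c
      c∈cops : lookup (cops s) (gv c) ≡ true
      c∈cops = subst (λ x → lookup (cops s) x ≡ true) i↦c (cop∈cops s i)
      c∈cops′ : lookup cops′ (gv c) ≡ true
      c∈cops′ = subst (λ x → lookup cops′ x ≡ true) i↦′c (cop′∈cops′ i)
      c≢robber : c ≢ robber s
      c≢robber refl with () ← trans (sym c∈cops) (robber∉cops s)
      c≢v′ : c ≢ proj₁ ans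
      c≢v′ refl = proj₁ (proj₂ (proj₂ ans)) (lookup⇒[]= (gv c) cops′ c∈cops′)

  ∣K∣ : ∀ N → ∣ replicate N false Vec.++ ⊤ {k} ∣ ≡ k
  ∣K∣ zero    = ∣⊤∣≡n k
  ∣K∣ (suc N) = ∣K∣ N

  initial : ∀ {q} (v : Fin (n G)) → RobberWins q K v →
    (T : EdgeSet (n G)) → IsJoin G (λ a → lookup U a xor δ v a) T → State
  initial {q} v wins T j = record
    { cops = K ; cop = n G ↑ʳ_ ; robber = v ; rounds = q ; robberWins = wins ; join = T
    ; ∣cops∣ = ∣K∣ (n G)
    ; cop∈cops = λ i → trans (lookup-++ʳ (replicate (n G) false) ⊤ i) (lookup-replicate i true)
    ; robber∉cops = trans (lookup-++ˡ (replicate (n G) false) ⊤ v) (lookup-replicate v false)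
    ; isJoin = j }

-- From a robber strategy to twists

module Strategy (G : Graph) (k′ : ℕ) (U : Subset (n G)) (F : Graph) {q : ℕ}
  (C : PebbleForestCover F (suc k′) q) (_⪯?_ : ∀ u v → Dec (PebbleForestCover._⪯_ C u v))
  (h : Vec (Fin (n G)) (n F)) (s₀ : Play.State G k′ U) (q≤rounds : q ≤ Play.State.rounds s₀)
  where
  open Play G k′ U
  open PebbleForestCover C
  open Game G (suc k′) using (gv)

  depth : Fin (n F) → ℕ
  depth z = length (filter (_⪯? z) (allFin (n F)))

  depth-mono : ∀ {w z} → w ⪯ z → depth w ≤ depth z
  depth-mono {w} {z} w⪯z = length-filter-mono (_⪯? w) (_⪯? z) (λ {u} u⪯w → trans⪯ u w z u⪯w w⪯z) (allFin (n F))

  depth-mono-< : ∀ {w z} → w ⪯ z → w ≢ z → depth w < depth z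
  depth-mono-< {w} {z} w⪯z w≢z = length-filter-mono-< (_⪯? w) (_⪯? z) (λ {u} u⪯w → trans⪯ u w z u⪯w w⪯z)
    (∈-allFin z) (λ z⪯w → w≢z (antisym w z w⪯z z⪯w)) (refl⪯ z)

  0<depth : ∀ z → 0 < depth z
  0<depth z = filter-some (_⪯? z) (Any.map (λ { refl → refl⪯ z }) (∈-allFin z))

  depth≤q : ∀ z → depth z ≤ q
  depth≤q z = height _ (chain (allFin (n F)) (Unique.allFin⁺ (n F)))
    where
    chain : ∀ xs → Unique xs → AllPairs (λ a b → a ≢ b × (a ⪯ b ⊎ b ⪯ a)) (filter (_⪯? z) xs)
    chain []       []         = []
    chain (a ∷ xs) (a∉ ∷ xs!) with a ⪯? z
    ... | no  _   = chain xs xs!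
    ... | yes a⪯z = comparable xs a∉ ∷ chain xs xs!
      where
      comparable : ∀ ys → All (a ≢_) ys → All (λ b → a ≢ b × (a ⪯ b ⊎ b ⪯ a)) (filter (_⪯? z) ys)
      comparable []       []           = []
      comparable (b ∷ ys) (a≢b ∷ a∉ys) with b ⪯? z
      ... | yes b⪯z = (a≢b , forest a b z a⪯z b⪯z) ∷ comparable ys a∉ys
      ... | no  _   = comparable ys a∉ys

  ancestorAt : Fin (n F) → ℕ → Maybe (Fin (n F))
  ancestorAt z i = find (λ w → (w ⪯? z) ×-dec (depth w ≟ℕ i)) (allFin (n F))

  ancestorAt-sound : ∀ z i {w} → ancestorAt z i ≡ just w → w ⪯ z × depth w ≡ i
  ancestorAt-sound z i = find-sound (λ w → (w ⪯? z) ×-dec (depth w ≟ℕ i)) (allFin (n F))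

  ancestorAt-depth : ∀ z → ancestorAt z (depth z) ≡ just z
  ancestorAt-depth z = find-unique (λ w → (w ⪯? z) ×-dec (depth w ≟ℕ depth z)) (∈-allFin z) (refl⪯ z , refl) unique
    where
    unique : ∀ {w} → w ⪯ z × depth w ≡ depth z → w ≡ z
    unique {w} (w⪯z , d≡) with w ≟ z
    ... | yes w≡z = w≡z
    ... | no  w≢z = ⊥-elim (<-irrefl d≡ (depth-mono-< w⪯z w≢z))

  ancestorAt-⪯ : ∀ {x y} → x ⪯ y → ∀ i → i ≤ depth x → ancestorAt x i ≡ ancestorAt y i
  ancestorAt-⪯ {x} {y} x⪯y i i≤dx = find-cong _ _ (λ (w⪯x , dw) → trans⪯ _ x y w⪯x x⪯y , dw) ⪯x (allFin (n F))
    where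
    ⪯x : ∀ {w} → w ⪯ y × depth w ≡ i → w ⪯ x × depth w ≡ i
    ⪯x {w} (w⪯y , dw) with forest w x y w⪯y x⪯y | w ≟ x
    ... | inj₁ w⪯x | _        = w⪯x , dw
    ... | inj₂ _   | yes refl = refl⪯ w , dw
    ... | inj₂ x⪯w | no  w≢x  =
      ⊥-elim (<-irrefl refl (<-≤-trans (depth-mono-< x⪯w (w≢x ∘ sym)) (subst (_≤ depth x) (sym dw) i≤dx)))

  placePebble : State → Fin (n F) → State
  placePebble s w = place s (lookup h w) (p w)

  play : Fin (n F) → ℕ → State
  play z zero    = s₀
  play z (suc i) = maybe (placePebble (play z i)) (play z i) (ancestorAt z (suc i))

  stateAt : Fin (n F) → State
  stateAt x = play x (depth x)

  play-⪯ : ∀ {x y} → x ⪯ y → ∀ i → i ≤ depth x → play x i ≡ play y i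
  play-⪯ x⪯y zero    _     = refl
  play-⪯ x⪯y (suc i) i<dx =
    cong₂ (λ s a → maybe (placePebble s) s a) (play-⪯ x⪯y i (≤-trans (n≤1+n i) i<dx)) (ancestorAt-⪯ x⪯y (suc i) i<dx)

  rounds-play : ∀ z i → q ≤ i + rounds (play z i)
  rounds-play z zero    = q≤rounds
  rounds-play z (suc i) with ancestorAt z (suc i)
  ... | nothing = ≤-trans (rounds-play z i) (n≤1+n _)
  ... | just w  = ≤-trans (rounds-play z i)
                    (subst (i + rounds (play z i) ≤_) (+-suc i _) (+-monoʳ-≤ i (rounds-place (play z i) (lookup h w) (p w))))

  cop-stateAt : ∀ x → cop (stateAt x) (p x) ≡ gv (lookup h x)
  cop-stateAt x = go (depth x) refl
    where
    go : ∀ d → depth x ≡ d → cop (play x d) (p x) ≡ gv (lookup h x)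
    go zero    d≡0 with () ← subst (0 <_) d≡0 (0<depth x)
    go (suc i) d≡  rewrite subst (λ d → ancestorAt x d ≡ just x) d≡ (ancestorAt-depth x) =
      place-cop (play x i) (lookup h x) (p x) 0<rounds
      where
      0<rounds : 0 < rounds (play x i)
      0<rounds with rounds (play x i) | rounds-play x i
      ... | suc _ | _     = s≤s z≤n
      ... | zero  | q≤i+0 = ⊥-elim (<-irrefl refl
            (≤-trans (subst (_≤ q) d≡ (depth≤q x)) (subst (q ≤_) (+-identityʳ i) q≤i+0)))

  Keeps : Fin (n F) → State → Set
  Keeps x s = cop s (p x) ≡ gv (lookup h x) × join s (lookup h x) ≗ join (stateAt x) (lookup h x)

  -- The pebble condition keeps cop p x on h x below x, and walks avoid the rows of cops.
  stateAt-keeps : ∀ {x y} → x ⪯ y → (∀ w → x ⪯ w → x ≢ w → w ⪯ y → p w ≢ p x) →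
    ∀ i → depth x ≤ i → Keeps x (play y i)
  stateAt-keeps {x} {y} x⪯y pebbled zero dx≤0 with () ← <-≤-trans (0<depth x) dx≤0
  stateAt-keeps {x} {y} x⪯y pebbled (suc i) dx≤ with depth x ≟ℕ suc i
  ... | yes dx≡ = subst (Keeps x ∘ play y) dx≡
                    (subst (Keeps x) (play-⪯ x⪯y (depth x) ≤-refl) (cop-stateAt x , λ _ → refl))
  ... | no  dx≢ with stateAt-keeps x⪯y pebbled i (≤-pred (≤∧≢⇒< dx≤ dx≢)) | ancestorAt y (suc i) in found
  ...   | ih | nothing = ih
  ...   | (x↦hx , row≗) | just w = proj₁ kept , λ b → trans (proj₂ kept b) (row≗ b)
    where
    w⪯y : w ⪯ y
    w⪯y = proj₁ (ancestorAt-sound y (suc i) found)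
    dx<dw : depth x < depth w
    dx<dw = subst (depth x <_) (sym (proj₂ (ancestorAt-sound y (suc i) found))) (≤∧≢⇒< dx≤ dx≢)
    x⪯w : x ⪯ w
    x⪯w with forest x w y x⪯y w⪯y
    ... | inj₁ x⪯w = x⪯w
    ... | inj₂ w⪯x = ⊥-elim (<-irrefl refl (<-≤-trans dx<dw (depth-mono w⪯x)))
    x≢w : x ≢ w
    x≢w refl = <-irrefl refl dx<dw
    kept : cop (placePebble (play y i) w) (p x) ≡ gv (lookup h x)
           × join (placePebble (play y i) w) (lookup h x) ≗ join (play y i) (lookup h x)
    kept = place-keeps (play y i) (lookup h w) (p w) (λ e → pebbled w x⪯w x≢w w⪯y (sym e)) x↦hx

  twist : Twist G U F h
  twist = record { D = D ; D⊆N = D⊆N ; parity-D = parity-D ; D-compatible = D-compatible }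
    where
    D : Fin (n F) → Subset (n G)
    D x = tabulate (join (stateAt x) (lookup h x))

    lookup-D : ∀ x u → lookup (D x) u ≡ join (stateAt x) (lookup h x) u
    lookup-D x = lookup∘tabulate (join (stateAt x) (lookup h x))

    D⊆N : ∀ x u → lookup (D x) u ≡ true → adj G (lookup h x) u ≡ true
    D⊆N x u e = ⊆E (isJoin (stateAt x)) (lookup h x) u (trans (sym (lookup-D x u)) e)

    parity-D : ∀ x → sum (lookup (D x)) ≡ lookup U (lookup h x)
    parity-D x = begin
      sum (lookup (D x))                                    ≡⟨ sum-cong-≗ (lookup-D x) ⟩
      sum (join (stateAt x) (lookup h x))                   ≡⟨ parity (isJoin (stateAt x)) (lookup h x) ⟩
      lookup U (lookup h x) xor δ (robber (stateAt x)) (lookup h x) ≡⟨ cong (lookup U (lookup h x) xor_) (δ-≢ robber≢hx) ⟩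
      lookup U (lookup h x) xor false                       ≡⟨ xor-identityʳ _ ⟩
      lookup U (lookup h x)                                 ∎
      where
      open ≡-Reasoning
      robber≢hx : robber (stateAt x) ≢ lookup h x
      robber≢hx r≡hx with () ← trans (sym (subst (λ c → lookup (cops (stateAt x)) c ≡ true)
                                  (trans (cop-stateAt x) (cong gv (sym r≡hx))) (cop∈cops (stateAt x) (p x))))
                                  (robber∉cops (stateAt x))

    compatible-⪯ : ∀ x y → adj F x y ≡ true → x ⪯ y → lookup (D x) (lookup h y) ≡ lookup (D y) (lookup h x)
    compatible-⪯ x y xy x⪯y = begin
      lookup (D x) (lookup h y)                           ≡⟨ lookup-D x (lookup h y) ⟩
      join (stateAt x) (lookup h x) (lookup h y)
        ≡⟨ sym (proj₂ (stateAt-keeps x⪯y pebbled (depth y) (depth-mono x⪯y)) (lookup h y)) ⟩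
      join (stateAt y) (lookup h x) (lookup h y)           ≡⟨ symmetric (isJoin (stateAt y)) (lookup h x) (lookup h y) ⟩
      join (stateAt y) (lookup h y) (lookup h x)           ≡⟨ sym (lookup-D y (lookup h x)) ⟩
      lookup (D y) (lookup h x)                           ∎
      where
      open ≡-Reasoning
      x≢y : x ≢ y
      x≢y refl with () ← trans (sym xy) (irr F x)
      pebbled : ∀ w → x ⪯ w → x ≢ w → w ⪯ y → p w ≢ p x
      pebbled = pebble x y xy x⪯y x≢y

    D-compatible : ∀ x y → adj F x y ≡ true → lookup (D x) (lookup h y) ≡ lookup (D y) (lookup h x)
    D-compatible x y xy with edgeComp x y xy
    ... | inj₁ x⪯y = compatible-⪯ x y xy x⪯y
    ... | inj₂ y⪯x = sym (compatible-⪯ y x (trans (Graph.sym F y x) xy) y⪯x)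

¬¬-∀Fin : ∀ {m} {P : Fin m → Set} → (∀ i → ¬ ¬ P i) → ¬ ¬ (∀ i → P i)
¬¬-∀Fin {zero}  ¬¬P ¬∀P = ¬∀P λ ()
¬¬-∀Fin {suc m} ¬¬P ¬∀P =
  ¬¬P zero λ P₀ → ¬¬-∀Fin (¬¬P ∘ suc) λ P₊ → ¬∀P λ { zero → P₀ ; (suc i) → P₊ i }

proposition43 : (k q : ℕ) → k ≥ 1 → (G : Graph) → Connected G →
    Game.RobberWinsCR G k q →
    (U : Data.Fin.Subset.Subset (n G)) → ∣ U ∣ % 2 ≡ 1 →
    HomIndistCFI G ⊥ U (𝒯 k q)
-- ⪯ need not be decidable, but the goal is an equation of naturals, hence stable
-- under double negation, so we may assume decidability.
proposition43 (suc k′) q (s≤s z≤n) G conn (v₀ , wins) U ∣U∣-odd F cover =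
  decidable-stable (homCFI F G ⊥ ≟ℕ homCFI F G U)
    (¬¬-map (λ _⪯?_ → homCFI-twist G U F λ h → Strategy.twist G k′ U F cover _⪯?_ h s₀ ≤-refl)
            (¬¬-∀Fin λ _ → ¬¬-∀Fin λ _ → ¬¬-excluded-middle))
  where
  even : sum (λ a → lookup U a xor δ v₀ a) ≡ false
  even = trans (∑-distrib-+ (lookup U) (δ v₀)) (cong₂ _xor_ (odd⇒parity U ∣U∣-odd) (sum-δ v₀))
  join₀ : Σ (EdgeSet (n G)) (IsJoin G λ a → lookup U a xor δ v₀ a)
  join₀ = join-exists G conn v₀ even
  s₀ : Play.State G k′ U
  s₀ = Play.initial G k′ U v₀ wins (proj₁ join₀) (proj₂ join₀)
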